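{- Let $S$ be a finite totally ordered set with $s=|S|$. For each $T\subseteq S$ let $B_T$ be an abelian group and put $A_T=\bigoplus_{T''\subseteq T}B_{T''}$; for $T''\subseteq T'$ let $x\mapsto x|_{T''}$ denote the natural projection $A_{T'}\to A_{T''}$. Fix $T\subseteq S$ and let $\mathcal{C}^\bullet_{S,T}$ be the cochain complex with \[\mathcal{C}^n_{S,T}=\bigoplus_{\substack{T'\supseteq S\setminus T\\|T'|=s-n}}A_{T'}\] and differential given on $A_{T'}$ by $x\mapsto\sum_{i\in T'\cap T}\omega(i,T'\cap T)\,x|_{T'\setminus\{i\}}\in\bigoplus_{i\in T'\cap T}A_{T'\setminus\{i\}}$, where $\omega(i,X)=(-1)^{|\{j\in X: j<i\}|}$. Then $H^n(\mathcal{C}^\bullet_{S,T})=0$ for $n\ne0$, and $H^0(\mathcal{C}^\bullet_{S,T})$ (the kernel of the differential on $\mathcal{C}^0_{S,T}=A_S$) equals $\bigoplus_{T'\supseteq T}B_{T'}\subseteq A_S$. -}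

module Defs where

open import Level using (Level; _⊔_)
open import Data.Nat using (ℕ; zero; suc; _+_)
open import Data.Fin using (Fin; zero; suc; _<?_)
open import Data.Vec using (tabulate)
open import Data.Bool using (Bool)
open import Data.Product using (_×_)
open import Relation.Nullary using (¬_; yes; no; does)
open import Relation.Binary.PropositionalEquality using (_≡_)
open import Algebra.Bundles using (AbelianGroup)
open import Data.Fin.Subset using (Subset; _⊆_; _∈_; _∉_; ∁; _∩_; _∪_; ⁅_⁆; ∣_∣; ⊤)
open import Data.Fin.Subset.Properties using (_⊆?_; _∈?_)

below : ∀ {s} → Fin s → Subset s
below i = tabulate (λ j → does (j <? i))

ωexp : ∀ {s} → Fin s → Subset s → ℕ
ωexp i X = ∣ X ∩ below i ∣

module _ {c ℓ : Level} (G : AbelianGroup c ℓ) where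
  open AbelianGroup G

  signed : ℕ → Carrier → Carrier
  signed zero x = x
  signed (suc k) x = (signed k x) ⁻¹

  sumFin : ∀ {n} → (Fin n → Carrier) → Carrier
  sumFin {zero} f = ε
  sumFin {suc n} f = f zero ∙ sumFin (λ i → f (suc i))

module _ {c ℓ : Level} {s : ℕ} (B : Subset s → AbelianGroup c ℓ) where
  private
    module B (U : Subset s) = AbelianGroup (B U)

  -- A cochain: for every index set T' the component in A_{T'}, which is
  -- represented as the family of its components in B_U (U ⊆ T');
  -- components outside the relevant support are required to vanish (see InC).
  Cochain : Set c
  Cochain = (T' U : Subset s) → B.Carrier U

  InC : (T : Subset s) → ℕ → Cochain → Set ℓ
  InC T n x = ∀ T' U → ¬ (∁ T ⊆ T' × ∣ T' ∣ + n ≡ s × U ⊆ T') →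
              B._≈_ U (x T' U) (B.ε U)

  -- Component at target index T'' and summand B_U: sum over i ∈ T, i ∉ T''
  -- (so that T' = T'' ∪ {i}), restricted to U ⊆ T''.
  d : (T : Subset s) → Cochain → Cochain
  d T x T'' U with U ⊆? T''
  ... | no _ = B.ε U
  ... | yes _ = sumFin (B U) term
    where
    term : Fin s → B.Carrier U
    term i with i ∈? T | i ∈? T''
    ... | yes _ | no _ = signed (B U) (ωexp i ((T'' ∪ ⁅ i ⁆) ∩ T)) (x (T'' ∪ ⁅ i ⁆) U)
    ... | _ | _ = B.ε U

  IsZero : Cochain → Set ℓ
  IsZero x = ∀ T' U → B._≈_ U (x T' U) (B.ε U)

  _≋_ : Cochain → Cochain → Set ℓ
  x ≋ y = ∀ T' U → B._≈_ U (x T' U) (y T' U)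

{-# OPTIONS --safe #-}
module Submission where

-- The complex is the direct sum over U ⊆ S of its B_U-parts, which live on
-- the index sets T' ⊇ (S ∖ T) ∪ U.  If some r ∈ T lies outside U, then
--   h_r(x)(T') = ω(r, T' ∩ T) · x(T' ∖ {r})   (and 0 when r ∉ T')
-- is a contracting homotopy of the B_U-part, d h_r + h_r d = id, because the
-- two ways of deleting r and another index i carry opposite signs.  So that
-- part is acyclic.  If T ⊆ U, the only admissible index set is T' = S, so the
-- B_U-part sits in degree 0 with zero differential.

open import Defs
open import Level using (Level)
open import Data.Nat using (ℕ; zero; suc; _+_)
open import Data.Nat.Properties using (+-comm; +-suc; +-identityʳ; m+1+n≢m; _≟_)
open import Data.Fin using (Fin; zero; suc; _<_; _<?_; punchIn)
open import Data.Fin.Properties using (any?; <-cmp; <-asym; punchInᵢ≢i)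
open import Data.Bool using (true; false)
open import Data.Vec using (_∷_; here; there)
open import Data.Vec.Properties using (lookup∘tabulate; lookup⇒[]=; []=⇒lookup)
open import Data.Product using (Σ; ∃; _×_; _,_; proj₁; proj₂)
open import Data.Sum using (inj₁; inj₂)
open import Data.Empty using (⊥-elim)
open import Function using (_∘_; case_of_)
open import Function.Bundles using (_⇔_; mk⇔)
open import Relation.Nullary using (¬_; yes; no; ¬?)
open import Relation.Nullary.Decidable using (dec-true; dec-false; decidable-stable; _×-dec_)
open import Relation.Nullary.Negation using (contradiction)
open import Relation.Binary.Definitions using (Tri; tri<; tri≈; tri>)
open import Relation.Binary.PropositionalEquality as ≡ using (_≡_; _≢_)
open import Algebra.Bundles using (AbelianGroup)
open import Data.Fin.Subset
  using (Subset; _⊆_; _∈_; _∉_; ∁; _∩_; _∪_; _─_; _-_; ⁅_⁆; ∣_∣; ⊤; ⊥; inside; outside)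
open import Data.Fin.Subset.Properties

module SignedSums {c ℓ : Level} (G : AbelianGroup c ℓ) where
  open AbelianGroup G
  open import Algebra.Properties.AbelianGroup G using (ε⁻¹≈ε; ⁻¹-involutive; ⁻¹-∙-comm)
  open import Algebra.Properties.CommutativeMonoid.Sum commutativeMonoid
    using (sum; sum-cong-≋; sum-replicate-zero; sum-remove; ∑-distrib-+) public
  open import Relation.Binary.Reasoning.Setoid setoid

  signed-cong : ∀ k {x y} → x ≈ y → signed G k x ≈ signed G k y
  signed-cong zero    x≈y = x≈y
  signed-cong (suc k) x≈y = ⁻¹-cong (signed-cong k x≈y)

  signed-ε : ∀ k → signed G k ε ≈ ε
  signed-ε zero    = refl
  signed-ε (suc k) = trans (⁻¹-cong (signed-ε k)) ε⁻¹≈ε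

  signed-vanishes : ∀ k {x} → x ≈ ε → signed G k x ≈ ε
  signed-vanishes k x≈ε = trans (signed-cong k x≈ε) (signed-ε k)

  signed-∙ : ∀ k x y → signed G k (x ∙ y) ≈ signed G k x ∙ signed G k y
  signed-∙ zero    x y = refl
  signed-∙ (suc k) x y = trans (⁻¹-cong (signed-∙ k x y)) (sym (⁻¹-∙-comm _ _))

  signed-+ : ∀ j k x → signed G j (signed G k x) ≡ signed G (j + k) x
  signed-+ zero    k x = ≡.refl
  signed-+ (suc j) k x = ≡.cong _⁻¹ (signed-+ j k x)

  signed-⁻¹ : ∀ k x → signed G k (x ⁻¹) ≡ signed G k x ⁻¹
  signed-⁻¹ zero    x = ≡.refl
  signed-⁻¹ (suc k) x = ≡.cong _⁻¹ (signed-⁻¹ k x)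

  signed-involutive : ∀ k x → signed G k (signed G k x) ≈ x
  signed-involutive zero    x = refl
  signed-involutive (suc k) x = begin
    signed G k (signed G k x ⁻¹) ⁻¹  ≡⟨ ≡.cong _⁻¹ (signed-⁻¹ k _) ⟩
    signed G k (signed G k x) ⁻¹ ⁻¹  ≈⟨ ⁻¹-involutive _ ⟩
    signed G k (signed G k x)        ≈⟨ signed-involutive k x ⟩
    x                                ∎

  sumFin≈sum : ∀ {n} {f g : Fin n → Carrier} → (∀ i → f i ≈ g i) → sumFin G f ≈ sum g
  sumFin≈sum {zero}  f≈g = refl
  sumFin≈sum {suc n} f≈g = ∙-cong (f≈g zero) (sumFin≈sum (f≈g ∘ suc))

  sum-vanishes : ∀ {n} {f : Fin n → Carrier} → (∀ i → f i ≈ ε) → sum f ≈ ε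
  sum-vanishes {n} f≈ε = trans (sum-cong-≋ f≈ε) (sum-replicate-zero n)

  sum-single : ∀ {n} {f : Fin n → Carrier} j → (∀ i → i ≢ j → f i ≈ ε) → sum f ≈ f j
  sum-single {suc n} {f} j f≈ε = begin
    sum f                      ≈⟨ sum-remove f ⟩
    f j ∙ sum (f ∘ punchIn j)  ≈⟨ ∙-congˡ (sum-vanishes (λ i → f≈ε _ (punchInᵢ≢i j i))) ⟩
    f j ∙ ε                    ≈⟨ identityʳ _ ⟩
    f j                        ∎

  sum-signed : ∀ {n} k (f : Fin n → Carrier) → sum (signed G k ∘ f) ≈ signed G k (sum f)
  sum-signed {zero}  k f = sym (signed-ε k)
  sum-signed {suc n} k f = trans (∙-congˡ (sum-signed k (f ∘ suc))) (sym (signed-∙ k _ _))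

private variable
  n : ℕ
  x y : Fin n
  p q : Subset n

module SubsetProperties where
  open ≡

  x∉p-x : ∀ (p : Subset n) x → x ∉ p - x
  x∉p-x (_ ∷ p) (suc x) (there x∈p-x) = x∉p-x p x x∈p-x

  x∈p∪⁅x⁆ : ∀ (p : Subset n) x → x ∈ p ∪ ⁅ x ⁆
  x∈p∪⁅x⁆ p x = x∈p∪q⁺ (inj₂ (x∈⁅x⁆ x))

  x∉p∧x≢y⇒x∉p∪⁅y⁆ : x ∉ p → x ≢ y → x ∉ p ∪ ⁅ y ⁆
  x∉p∧x≢y⇒x∉p∪⁅y⁆ {p = p} x∉p x≢y x∈ with x∈p∪q⁻ p _ x∈
  ... | inj₁ x∈p  = x∉p x∈p
  ... | inj₂ x∈⁅y⁆ = x≢y (x∈⁅y⁆⇒x≡y _ x∈⁅y⁆)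

  [p-x]∪⁅x⁆≡p : x ∈ p → (p - x) ∪ ⁅ x ⁆ ≡ p
  [p-x]∪⁅x⁆≡p {p = _       ∷ p} here        = cong (true ∷_) (trans (∪-identityʳ (p ─ ⊥)) (p─⊥≡p p))
  [p-x]∪⁅x⁆≡p {p = outside ∷ p} (there x∈p) = cong (false ∷_) ([p-x]∪⁅x⁆≡p x∈p)
  [p-x]∪⁅x⁆≡p {p = inside  ∷ p} (there x∈p) = cong (true ∷_) ([p-x]∪⁅x⁆≡p x∈p)

  [p∪⁅x⁆]-x≡p : x ∉ p → (p ∪ ⁅ x ⁆) - x ≡ p
  [p∪⁅x⁆]-x≡p {x = zero} {p = inside ∷ p} x∉p = contradiction here x∉p
  [p∪⁅x⁆]-x≡p {x = zero} {p = outside ∷ p} x∉p = cong (false ∷_) (trans (p─⊥≡p (p ∪ ⊥)) (∪-identityʳ p))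
  [p∪⁅x⁆]-x≡p {x = suc x} {p = outside ∷ p} x∉p = cong (false ∷_) ([p∪⁅x⁆]-x≡p (drop-not-there x∉p))
  [p∪⁅x⁆]-x≡p {x = suc x} {p = inside ∷ p} x∉p = cong (true ∷_) ([p∪⁅x⁆]-x≡p (drop-not-there x∉p))

  [p∪⁅x⁆]-y≡[p-y]∪⁅x⁆ : ∀ (p : Subset n) → x ≢ y → (p ∪ ⁅ x ⁆) - y ≡ (p - y) ∪ ⁅ x ⁆
  [p∪⁅x⁆]-y≡[p-y]∪⁅x⁆ {x = zero} {y = zero} p x≢y = contradiction refl x≢y
  [p∪⁅x⁆]-y≡[p-y]∪⁅x⁆ {x = zero} {y = suc y} (_ ∷ p) _ =
    cong (_ ∷_) (trans (cong (_- y) (∪-identityʳ p)) (sym (∪-identityʳ (p - y))))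
  [p∪⁅x⁆]-y≡[p-y]∪⁅x⁆ {x = suc x} {y = zero} (_ ∷ p) _ =
    cong (_ ∷_) (trans (p─⊥≡p (p ∪ ⁅ x ⁆)) (cong (_∪ ⁅ x ⁆) (sym (p─⊥≡p p))))
  [p∪⁅x⁆]-y≡[p-y]∪⁅x⁆ {x = suc x} {y = suc y} (_ ∷ p) sx≢sy =
    cong (_ ∷_) ([p∪⁅x⁆]-y≡[p-y]∪⁅x⁆ p (sx≢sy ∘ cong suc))

  ∣p∪⁅x⁆∣≡1+∣p∣ : x ∉ p → ∣ p ∪ ⁅ x ⁆ ∣ ≡ suc ∣ p ∣
  ∣p∪⁅x⁆∣≡1+∣p∣ {x = zero} {p = inside ∷ p} x∉p = contradiction here x∉p
  ∣p∪⁅x⁆∣≡1+∣p∣ {x = zero} {p = outside ∷ p} x∉p = cong (suc ∘ ∣_∣) (∪-identityʳ p)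
  ∣p∪⁅x⁆∣≡1+∣p∣ {x = suc x} {p = outside ∷ p} x∉p = ∣p∪⁅x⁆∣≡1+∣p∣ (drop-not-there x∉p)
  ∣p∪⁅x⁆∣≡1+∣p∣ {x = suc x} {p = inside ∷ p} x∉p = cong suc (∣p∪⁅x⁆∣≡1+∣p∣ (drop-not-there x∉p))

  ∣p∣≡1+∣p-x∣ : x ∈ p → ∣ p ∣ ≡ suc ∣ p - x ∣
  ∣p∣≡1+∣p-x∣ {x = x} {p = p} x∈p =
    trans (cong ∣_∣ (sym ([p-x]∪⁅x⁆≡p x∈p))) (∣p∪⁅x⁆∣≡1+∣p∣ (x∉p-x p x))

  ⁅x⁆∩p≡⁅x⁆ : x ∈ p → ⁅ x ⁆ ∩ p ≡ ⁅ x ⁆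
  ⁅x⁆∩p≡⁅x⁆ here = cong (true ∷_) (∩-zeroˡ _)
  ⁅x⁆∩p≡⁅x⁆ (there x∈p) = cong (false ∷_) (⁅x⁆∩p≡⁅x⁆ x∈p)

  ⁅x⁆∩p≡⊥ : x ∉ p → ⁅ x ⁆ ∩ p ≡ ⊥
  ⁅x⁆∩p≡⊥ {x = zero} {p = inside ∷ p} x∉p = contradiction here x∉p
  ⁅x⁆∩p≡⊥ {x = zero} {p = outside ∷ p} x∉p = cong (false ∷_) (∩-zeroˡ p)
  ⁅x⁆∩p≡⊥ {x = suc x} {p = _ ∷ p} x∉p = cong (false ∷_) (⁅x⁆∩p≡⊥ (drop-not-there x∉p))

  [p∪⁅x⁆]∩q≡p∩q : ∀ (p : Subset n) → x ∉ q → (p ∪ ⁅ x ⁆) ∩ q ≡ p ∩ q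
  [p∪⁅x⁆]∩q≡p∩q {x = x} {q = q} p x∉q = begin
    (p ∪ ⁅ x ⁆) ∩ q        ≡⟨ ∩-distribʳ-∪ q p ⁅ x ⁆ ⟩
    (p ∩ q) ∪ (⁅ x ⁆ ∩ q)  ≡⟨ cong ((p ∩ q) ∪_) (⁅x⁆∩p≡⊥ x∉q) ⟩
    (p ∩ q) ∪ ⊥            ≡⟨ ∪-identityʳ (p ∩ q) ⟩
    p ∩ q                  ∎
    where open ≡-Reasoning

  ∣[p∪⁅x⁆]∩q∣≡1+∣p∩q∣ : ∀ (p : Subset n) → x ∉ p → x ∈ q → ∣ (p ∪ ⁅ x ⁆) ∩ q ∣ ≡ suc ∣ p ∩ q ∣
  ∣[p∪⁅x⁆]∩q∣≡1+∣p∩q∣ {x = x} {q = q} p x∉p x∈q = begin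
    ∣ (p ∪ ⁅ x ⁆) ∩ q ∣        ≡⟨ cong ∣_∣ (∩-distribʳ-∪ q p ⁅ x ⁆) ⟩
    ∣ (p ∩ q) ∪ (⁅ x ⁆ ∩ q) ∣  ≡⟨ cong (λ r → ∣ (p ∩ q) ∪ r ∣) (⁅x⁆∩p≡⁅x⁆ x∈q) ⟩
    ∣ (p ∩ q) ∪ ⁅ x ⁆ ∣        ≡⟨ ∣p∪⁅x⁆∣≡1+∣p∣ (x∉p ∘ proj₁ ∘ x∈p∩q⁻ p q) ⟩
    suc ∣ p ∩ q ∣              ∎
    where open ≡-Reasoning

  p⊆q∧∁p⊆q⇒q≡⊤ : p ⊆ q → ∁ p ⊆ q → q ≡ ⊤
  p⊆q∧∁p⊆q⇒q≡⊤ {p = p} p⊆q ∁p⊆q = ⊆-antisym ⊆⊤ λ {x} _ → case x ∈? p of λ where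
    (yes x∈p) → p⊆q x∈p
    (no x∉p)  → ∁p⊆q (x∉p⇒x∈∁p x∉p)

  p⊈q⇒∃∈∉ : ¬ p ⊆ q → ∃ λ x → x ∈ p × x ∉ q
  p⊈q⇒∃∈∉ {p = p} {q = q} p⊈q with any? (λ x → x ∈? p ×-dec ¬? (x ∈? q))
  ... | yes x∈p∖q = x∈p∖q
  ... | no ∄x∈p∖q = contradiction
    (λ {x} x∈p → decidable-stable (x ∈? q) (λ x∉q → ∄x∈p∖q (x , x∈p , x∉q))) p⊈q

  x∈below : x < y → x ∈ below y
  x∈below {x = x} {y = y} x<y =
    lookup⇒[]= x (below y) (trans (lookup∘tabulate _ x) (dec-true (x <? y) x<y))

  x∉below : ¬ x < y → x ∉ below y
  x∉below {x = x} {y = y} x≮y x∈below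
    with () ← trans (sym ([]=⇒lookup x∈below)) (trans (lookup∘tabulate _ x) (dec-false (x <? y) x≮y))

  ωexp-∪⁅⁆-< : ∀ (p : Subset n) → x ∉ p → x ∈ q → x < y → ωexp y ((p ∪ ⁅ x ⁆) ∩ q) ≡ suc (ωexp y (p ∩ q))
  ωexp-∪⁅⁆-< {x = x} {q = q} {y = y} p x∉p x∈q x<y = begin
    ∣ ((p ∪ ⁅ x ⁆) ∩ q) ∩ below y ∣  ≡⟨ cong ∣_∣ (∩-assoc (p ∪ ⁅ x ⁆) q (below y)) ⟩
    ∣ (p ∪ ⁅ x ⁆) ∩ (q ∩ below y) ∣  ≡⟨ ∣[p∪⁅x⁆]∩q∣≡1+∣p∩q∣ p x∉p (x∈p∩q⁺ (x∈q , x∈below x<y)) ⟩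
    suc ∣ p ∩ (q ∩ below y) ∣        ≡⟨ cong (suc ∘ ∣_∣) (∩-assoc p q (below y)) ⟨
    suc ∣ (p ∩ q) ∩ below y ∣        ∎
    where open ≡-Reasoning

  ωexp-∪⁅⁆-≮ : ∀ (p : Subset n) → ¬ x < y → ωexp y ((p ∪ ⁅ x ⁆) ∩ q) ≡ ωexp y (p ∩ q)
  ωexp-∪⁅⁆-≮ {x = x} {y = y} {q = q} p x≮y = cong ∣_∣ (begin
    ((p ∪ ⁅ x ⁆) ∩ q) ∩ below y  ≡⟨ ∩-assoc (p ∪ ⁅ x ⁆) q (below y) ⟩
    (p ∪ ⁅ x ⁆) ∩ (q ∩ below y)  ≡⟨ [p∪⁅x⁆]∩q≡p∩q p (x∉below x≮y ∘ proj₂ ∘ x∈p∩q⁻ q (below y)) ⟩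
    p ∩ (q ∩ below y)            ≡⟨ ∩-assoc p q (below y) ⟨
    (p ∩ q) ∩ below y            ∎)
    where open ≡-Reasoning

  ωexp-exchange : ∀ {i r : Fin n} (p q : Subset n) → r ∈ p → r ∈ q → i ∉ p → i ∈ q → i ≢ r →
    ωexp i ((p ∪ ⁅ i ⁆) ∩ q) + ωexp r ((p ∪ ⁅ i ⁆) ∩ q) ≡
    suc (ωexp r (p ∩ q) + ωexp i (((p - r) ∪ ⁅ i ⁆) ∩ q))
  ωexp-exchange {i = i} {r} p q r∈p r∈q i∉p i∈q i≢r = exchange (<-cmp r i)
    where
    open ≡-Reasoning
    p′ : Subset _
    p′ = (p - r) ∪ ⁅ i ⁆

    r∉p′ : r ∉ p′
    r∉p′ = x∉p∧x≢y⇒x∉p∪⁅y⁆ (x∉p-x p r) (i≢r ∘ sym)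

    p∪⁅i⁆≡p′∪⁅r⁆ : p ∪ ⁅ i ⁆ ≡ p′ ∪ ⁅ r ⁆
    p∪⁅i⁆≡p′∪⁅r⁆ = begin
      p ∪ ⁅ i ⁆                  ≡⟨ [p-x]∪⁅x⁆≡p (x∈p∪q⁺ (inj₁ r∈p)) ⟨
      ((p ∪ ⁅ i ⁆) - r) ∪ ⁅ r ⁆  ≡⟨ cong (_∪ ⁅ r ⁆) ([p∪⁅x⁆]-y≡[p-y]∪⁅x⁆ p i≢r) ⟩
      p′ ∪ ⁅ r ⁆                 ∎

    ωexp-i : ωexp i ((p ∪ ⁅ i ⁆) ∩ q) ≡ ωexp i ((p′ ∪ ⁅ r ⁆) ∩ q)
    ωexp-i = cong (λ t → ωexp i (t ∩ q)) p∪⁅i⁆≡p′∪⁅r⁆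

    exchange : Tri (r < i) (r ≡ i) (i < r) →
      ωexp i ((p ∪ ⁅ i ⁆) ∩ q) + ωexp r ((p ∪ ⁅ i ⁆) ∩ q) ≡ suc (ωexp r (p ∩ q) + ωexp i (p′ ∩ q))
    exchange (tri< r<i _ _) = begin
      ωexp i ((p ∪ ⁅ i ⁆) ∩ q) + ωexp r ((p ∪ ⁅ i ⁆) ∩ q)
        ≡⟨ cong₂ _+_ (trans ωexp-i (ωexp-∪⁅⁆-< p′ r∉p′ r∈q r<i)) (ωexp-∪⁅⁆-≮ p (<-asym r<i)) ⟩
      suc (ωexp i (p′ ∩ q)) + ωexp r (p ∩ q)
        ≡⟨ cong suc (+-comm (ωexp i (p′ ∩ q)) _) ⟩
      suc (ωexp r (p ∩ q) + ωexp i (p′ ∩ q))  ∎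
    exchange (tri≈ _ r≡i _) = contradiction (sym r≡i) i≢r
    exchange (tri> _ _ i<r) = begin
      ωexp i ((p ∪ ⁅ i ⁆) ∩ q) + ωexp r ((p ∪ ⁅ i ⁆) ∩ q)
        ≡⟨ cong₂ _+_ (trans ωexp-i (ωexp-∪⁅⁆-≮ p′ (<-asym i<r))) (ωexp-∪⁅⁆-< p i∉p i∈q i<r) ⟩
      ωexp i (p′ ∩ q) + suc (ωexp r (p ∩ q))
        ≡⟨ +-suc (ωexp i (p′ ∩ q)) _ ⟩
      suc (ωexp i (p′ ∩ q) + ωexp r (p ∩ q))
        ≡⟨ cong suc (+-comm (ωexp i (p′ ∩ q)) _) ⟩
      suc (ωexp r (p ∩ q) + ωexp i (p′ ∩ q))  ∎

open SubsetProperties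

module Complex {c ℓ : Level} {s : ℕ} (B : Subset s → AbelianGroup c ℓ) (T : Subset s) where
  private module Bᵤ (U : Subset s) = AbelianGroup (B U)

  0ᶜ : Cochain B
  0ᶜ T' U = Bᵤ.ε U

  homotopy : Fin s → Cochain B → Cochain B
  homotopy r x T' U with r ∈? T'
  ... | yes _ = signed (B U) (ωexp r (T' ∩ T)) (x (T' - r) U)
  ... | no  _ = Bᵤ.ε U

  homotopy-InC : ∀ {n} r x → InC B T (suc n) x → InC B T n (homotopy r x)
  homotopy-InC {n} r x x∈C T' U excluded with r ∈? T'
  ... | no _     = Bᵤ.refl U
  ... | yes r∈T' = SignedSums.signed-vanishes (B U) (ωexp r (T' ∩ T)) (x∈C (T' - r) U excluded′)
    where
    excluded′ : ¬ (∁ T ⊆ T' - r × ∣ T' - r ∣ + suc n ≡ s × U ⊆ T' - r)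
    excluded′ (∁T⊆T'-r , size , U⊆T'-r) = excluded
      ( ⊆-trans ∁T⊆T'-r (p─q⊆p T' ⁅ r ⁆)
      , ≡.trans (≡.cong (_+ n) (∣p∣≡1+∣p-x∣ r∈T')) (≡.trans (≡.sym (+-suc ∣ T' - r ∣ n)) size)
      , ⊆-trans U⊆T'-r (p─q⊆p T' ⁅ r ⁆) )

  -- In positive degree every index set T' ⊇ S ∖ T is proper, so it cannot also contain T.
  InC-suc-vanishes-if-T⊆U : ∀ {n} x → InC B T (suc n) x → ∀ T'' U → T ⊆ U → Bᵤ._≈_ U (x T'' U) (Bᵤ.ε U)
  InC-suc-vanishes-if-T⊆U {n} x x∈C T'' U T⊆U = x∈C T'' U excluded
    where
    open ≡.≡-Reasoning
    excluded : ¬ (∁ T ⊆ T'' × ∣ T'' ∣ + suc n ≡ s × U ⊆ T'')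
    excluded (∁T⊆T'' , size , U⊆T'') = m+1+n≢m s (begin
      s + suc n
        ≡⟨ ≡.cong (_+ suc n) (∣⊤∣≡n s) ⟨
      ∣ ⊤ {s} ∣ + suc n
        ≡⟨ ≡.cong (λ (t : Subset s) → ∣ t ∣ + suc n) (p⊆q∧∁p⊆q⇒q≡⊤ (⊆-trans T⊆U U⊆T'') ∁T⊆T'') ⟨
      ∣ T'' ∣ + suc n
        ≡⟨ size ⟩
      s ∎)

  module Summand (U : Subset s) where
    open AbelianGroup (B U) hiding (_-_)
    open SignedSums (B U)
    open import Relation.Binary.Reasoning.Setoid setoid

    σ : ℕ → Carrier → Carrier
    σ = signed (B U)

    dTerm : Cochain B → Subset s → Fin s → Carrier
    dTerm x T'' i with i ∈? T | i ∈? T''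
    ... | yes _ | no _ = σ (ωexp i ((T'' ∪ ⁅ i ⁆) ∩ T)) (x (T'' ∪ ⁅ i ⁆) U)
    ... | _     | _    = ε

    -- The left-hand side is the summand of d, which is local to Defs and
    -- cannot be named; it is inferred from the use in d-⊆ below.
    summand≈dTerm : ∀ x T'' (U⊆T'' : U ⊆ T'') i → _ ≈ dTerm x T'' i

    d-⊆ : ∀ x T'' → U ⊆ T'' → d B T x T'' U ≈ sum (dTerm x T'')
    d-⊆ x T'' U⊆T'' with U ⊆? T''
    ... | no U⊈T''  = ⊥-elim (U⊈T'' U⊆T'')
    ... | yes U⊆T'' = sumFin≈sum (summand≈dTerm x T'' U⊆T'')

    summand≈dTerm x T'' _ i with i ∈? T | i ∈? T''
    ... | yes _ | no _  = refl
    ... | yes _ | yes _ = refl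
    ... | no _  | _     = refl

    d-⊈ : ∀ x T'' → ¬ U ⊆ T'' → d B T x T'' U ≈ ε
    d-⊈ x T'' U⊈T'' with U ⊆? T''
    ... | no _         = refl
    ... | yes U⊆T''    = ⊥-elim (U⊈T'' U⊆T'')

    dTerm-active : ∀ x T'' {i} → i ∈ T → i ∉ T'' →
      dTerm x T'' i ≡ σ (ωexp i ((T'' ∪ ⁅ i ⁆) ∩ T)) (x (T'' ∪ ⁅ i ⁆) U)
    dTerm-active x T'' {i} i∈T i∉T'' with i ∈? T | i ∈? T''
    ... | yes _   | no _       = ≡.refl
    ... | yes _   | yes i∈T''  = contradiction i∈T'' i∉T''
    ... | no i∉T  | _          = contradiction i∈T i∉T

    dTerm-vanishes : ∀ x T'' {i} → (i ∈ T → i ∉ T'' → x (T'' ∪ ⁅ i ⁆) U ≈ ε) → dTerm x T'' i ≈ ε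
    dTerm-vanishes x T'' {i} x≈ε with i ∈? T | i ∈? T''
    ... | yes i∈T | no i∉T'' = signed-vanishes (ωexp i ((T'' ∪ ⁅ i ⁆) ∩ T)) (x≈ε i∈T i∉T'')
    ... | yes _   | yes _    = refl
    ... | no _    | _        = refl

    dTerm-inactive : ∀ x T'' {i} → ¬ (i ∈ T × i ∉ T'') → dTerm x T'' i ≈ ε
    dTerm-inactive x T'' inactive =
      dTerm-vanishes x T'' (λ i∈T i∉T'' → contradiction (i∈T , i∉T'') inactive)

    dTerm-cong : ∀ {x z} T'' i → (∀ T' → x T' U ≈ z T' U) → dTerm x T'' i ≈ dTerm z T'' i
    dTerm-cong T'' i x≈z with i ∈? T | i ∈? T''
    ... | yes _ | no _  = signed-cong (ωexp i ((T'' ∪ ⁅ i ⁆) ∩ T)) (x≈z (T'' ∪ ⁅ i ⁆))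
    ... | yes _ | yes _ = refl
    ... | no _  | _     = refl

    d-cong : ∀ {x z} T'' → (∀ T' → x T' U ≈ z T' U) → d B T x T'' U ≈ d B T z T'' U
    d-cong {x} {z} T'' x≈z = case U ⊆? T'' of λ where
      (yes U⊆T'') → begin
        d B T x T'' U       ≈⟨ d-⊆ x T'' U⊆T'' ⟩
        sum (dTerm x T'')   ≈⟨ sum-cong-≋ (λ i → dTerm-cong T'' i x≈z) ⟩
        sum (dTerm z T'')   ≈⟨ d-⊆ z T'' U⊆T'' ⟨
        d B T z T'' U       ∎
      (no U⊈T'') → trans (d-⊈ x T'' U⊈T'') (sym (d-⊈ z T'' U⊈T''))

    d-vanishes : ∀ x T'' → (U ⊆ T'' → ∀ i → i ∈ T → i ∉ T'' → x (T'' ∪ ⁅ i ⁆) U ≈ ε) →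
      d B T x T'' U ≈ ε
    d-vanishes x T'' x≈ε = case U ⊆? T'' of λ where
      (yes U⊆T'') → trans (d-⊆ x T'' U⊆T'') (sum-vanishes (λ i → dTerm-vanishes x T'' (x≈ε U⊆T'' i)))
      (no U⊈T'')  → d-⊈ x T'' U⊈T''

    homotopy-∈ : ∀ {r} x T' → r ∈ T' → homotopy r x T' U ≡ σ (ωexp r (T' ∩ T)) (x (T' - r) U)
    homotopy-∈ {r} x T' r∈T' with r ∈? T'
    ... | yes _     = ≡.refl
    ... | no r∉T'   = contradiction r∈T' r∉T'

    homotopy-∉ : ∀ {r} x T' → r ∉ T' → homotopy r x T' U ≡ ε
    homotopy-∉ {r} x T' r∉T' with r ∈? T'
    ... | yes r∈T'  = contradiction r∈T' r∉T'
    ... | no _      = ≡.refl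

    homotopy-vanishes : ∀ r x T' → (∀ T'' → x T'' U ≈ ε) → homotopy r x T' U ≈ ε
    homotopy-vanishes r x T' x≈ε with r ∈? T'
    ... | yes _ = signed-vanishes (ωexp r (T' ∩ T)) (x≈ε (T' - r))
    ... | no _  = refl

    d-homotopy-∉ : ∀ {r} x T'' → r ∈ T → r ∉ T'' → U ⊆ T'' → d B T (homotopy r x) T'' U ≈ x T'' U
    d-homotopy-∉ {r} x T'' r∈T r∉T'' U⊆T'' = begin
      d B T (homotopy r x) T'' U
        ≈⟨ d-⊆ (homotopy r x) T'' U⊆T'' ⟩
      sum (dTerm (homotopy r x) T'')
        ≈⟨ sum-single r only-r ⟩
      dTerm (homotopy r x) T'' r
        ≡⟨ dTerm-active (homotopy r x) T'' r∈T r∉T'' ⟩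
      σ k (homotopy r x (T'' ∪ ⁅ r ⁆) U)
        ≡⟨ ≡.cong (σ k) (homotopy-∈ x (T'' ∪ ⁅ r ⁆) (x∈p∪⁅x⁆ T'' r)) ⟩
      σ k (σ k (x ((T'' ∪ ⁅ r ⁆) - r) U))
        ≈⟨ signed-involutive k _ ⟩
      x ((T'' ∪ ⁅ r ⁆) - r) U
        ≡⟨ ≡.cong (λ t → x t U) ([p∪⁅x⁆]-x≡p r∉T'') ⟩
      x T'' U ∎
      where
      k : ℕ
      k = ωexp r ((T'' ∪ ⁅ r ⁆) ∩ T)

      only-r : ∀ i → i ≢ r → dTerm (homotopy r x) T'' i ≈ ε
      only-r i i≢r = dTerm-vanishes (homotopy r x) T'' λ _ _ →
        reflexive (homotopy-∉ x (T'' ∪ ⁅ i ⁆) (x∉p∧x≢y⇒x∉p∪⁅y⁆ r∉T'' (i≢r ∘ ≡.sym)))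

    -- The two ways from T'' ∪ ⁅ i ⁆ down to T'' - r, through removing r or i
    -- first, carry opposite signs.
    exchange-cancels : ∀ {r i} x T'' → r ∈ T → r ∈ T'' → i ∈ T → i ∉ T'' → i ≢ r →
      dTerm (homotopy r x) T'' i ∙ σ (ωexp r (T'' ∩ T)) (dTerm x (T'' - r) i) ≈ ε
    exchange-cancels {r} {i} x T'' r∈T r∈T'' i∈T i∉T'' i≢r = begin
      dTerm (homotopy r x) T'' i ∙ σ κ (dTerm x (T'' - r) i)
        ≡⟨ ≡.cong₂ _∙_ (dTerm-active (homotopy r x) T'' i∈T i∉T'')
                       (≡.cong (σ κ) (dTerm-active x (T'' - r) i∈T (i∉T'' ∘ p─q⊆p T'' ⁅ r ⁆))) ⟩
      σ a (homotopy r x (T'' ∪ ⁅ i ⁆) U) ∙ σ κ (σ e w)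
        ≡⟨ ≡.cong (λ t → σ a t ∙ σ κ (σ e w)) (homotopy-∈ x (T'' ∪ ⁅ i ⁆) (x∈p∪q⁺ (inj₁ r∈T''))) ⟩
      σ a (σ b (x ((T'' ∪ ⁅ i ⁆) - r) U)) ∙ σ κ (σ e w)
        ≡⟨ ≡.cong (λ t → σ a (σ b (x t U)) ∙ σ κ (σ e w)) ([p∪⁅x⁆]-y≡[p-y]∪⁅x⁆ T'' i≢r) ⟩
      σ a (σ b w) ∙ σ κ (σ e w)
        ≡⟨ ≡.cong₂ _∙_ (signed-+ a b w) (signed-+ κ e w) ⟩
      σ (a + b) w ∙ σ (κ + e) w
        ≡⟨ ≡.cong (λ k → σ k w ∙ σ (κ + e) w) (ωexp-exchange T'' T r∈T'' r∈T i∉T'' i∈T i≢r) ⟩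
      σ (κ + e) w ⁻¹ ∙ σ (κ + e) w
        ≈⟨ inverseˡ _ ⟩
      ε ∎
      where
      a b κ e : ℕ
      a = ωexp i ((T'' ∪ ⁅ i ⁆) ∩ T)
      b = ωexp r ((T'' ∪ ⁅ i ⁆) ∩ T)
      κ = ωexp r (T'' ∩ T)
      e = ωexp i (((T'' - r) ∪ ⁅ i ⁆) ∩ T)

      w : Carrier
      w = x ((T'' - r) ∪ ⁅ i ⁆) U

    d-homotopy-∈ : ∀ {r} x T'' → r ∈ T → r ∉ U → r ∈ T'' → U ⊆ T'' →
      d B T (homotopy r x) T'' U ∙ homotopy r (d B T x) T'' U ≈ x T'' U
    d-homotopy-∈ {r} x T'' r∈T r∉U r∈T'' U⊆T'' = begin
      d B T (homotopy r x) T'' U ∙ homotopy r (d B T x) T'' U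
        ≈⟨ ∙-cong (d-⊆ (homotopy r x) T'' U⊆T'') (reflexive (homotopy-∈ (d B T x) T'' r∈T'')) ⟩
      sum (dTerm (homotopy r x) T'') ∙ σ κ (d B T x R U)
        ≈⟨ ∙-congˡ (signed-cong κ (d-⊆ x R U⊆R)) ⟩
      sum (dTerm (homotopy r x) T'') ∙ σ κ (sum (dTerm x R))
        ≈⟨ ∙-congˡ (sum-signed κ (dTerm x R)) ⟨
      sum (dTerm (homotopy r x) T'') ∙ sum (σ κ ∘ dTerm x R)
        ≈⟨ ∑-distrib-+ (dTerm (homotopy r x) T'') (σ κ ∘ dTerm x R) ⟨
      sum (λ i → dTerm (homotopy r x) T'' i ∙ σ κ (dTerm x R i))
        ≈⟨ sum-single r pairs-cancel ⟩
      dTerm (homotopy r x) T'' r ∙ σ κ (dTerm x R r)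
        ≈⟨ ∙-cong (dTerm-inactive (homotopy r x) T'' (λ (_ , r∉T'') → r∉T'' r∈T''))
                  (reflexive (≡.cong (σ κ) (dTerm-active x R r∈T (x∉p-x T'' r)))) ⟩
      ε ∙ σ κ (σ (ωexp r ((R ∪ ⁅ r ⁆) ∩ T)) (x (R ∪ ⁅ r ⁆) U))
        ≡⟨ ≡.cong (λ t → ε ∙ σ κ (σ (ωexp r (t ∩ T)) (x t U))) ([p-x]∪⁅x⁆≡p r∈T'') ⟩
      ε ∙ σ κ (σ κ (x T'' U))
        ≈⟨ trans (identityˡ _) (signed-involutive κ _) ⟩
      x T'' U ∎
      where
      R : Subset s
      R = T'' - r

      κ : ℕ
      κ = ωexp r (T'' ∩ T)

      U⊆R : U ⊆ R
      U⊆R u∈U = x∈p∧x≢y⇒x∈p-y (U⊆T'' u∈U) λ { ≡.refl → r∉U u∈U }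

      pairs-cancel : ∀ i → i ≢ r → dTerm (homotopy r x) T'' i ∙ σ κ (dTerm x R i) ≈ ε
      pairs-cancel i i≢r = case i ∈? T ×-dec ¬? (i ∈? T'') of λ where
        (yes (i∈T , i∉T'')) → exchange-cancels x T'' r∈T r∈T'' i∈T i∉T'' i≢r
        (no inactive) → trans
          (∙-cong (dTerm-inactive (homotopy r x) T'' inactive)
                  (signed-vanishes κ (dTerm-inactive x R λ (i∈T , i∉R) →
                     inactive (i∈T , λ i∈T'' → i∉R (x∈p∧x≢y⇒x∈p-y i∈T'' i≢r)))))
          (identityˡ ε)

    homotopy-formula : ∀ {r} x T'' → r ∈ T → r ∉ U → U ⊆ T'' →
      d B T (homotopy r x) T'' U ∙ homotopy r (d B T x) T'' U ≈ x T'' U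
    homotopy-formula {r} x T'' r∈T r∉U U⊆T'' = case r ∈? T'' of λ where
      (yes r∈T'') → d-homotopy-∈ x T'' r∈T r∉U r∈T'' U⊆T''
      (no r∉T'')  → begin
        d B T (homotopy r x) T'' U ∙ homotopy r (d B T x) T'' U
          ≡⟨ ≡.cong (d B T (homotopy r x) T'' U ∙_) (homotopy-∉ (d B T x) T'' r∉T'') ⟩
        d B T (homotopy r x) T'' U ∙ ε
          ≈⟨ identityʳ _ ⟩
        d B T (homotopy r x) T'' U
          ≈⟨ d-homotopy-∉ x T'' r∈T r∉T'' U⊆T'' ⟩
        x T'' U ∎

    exact-on-summand : ∀ {n} x → InC B T (suc n) x → IsZero B (d B T x) →
      Σ (Cochain B) λ y → InC B T n y × (∀ T'' → d B T y T'' U ≈ x T'' U)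
    exact-on-summand x x∈C dx≈0 = case T ⊆? U of λ where
      (yes T⊆U) → 0ᶜ , (λ _ U′ _ → Bᵤ.refl U′) , λ T'' →
        trans (d-vanishes 0ᶜ T'' λ _ _ _ _ → refl) (sym (InC-suc-vanishes-if-T⊆U x x∈C T'' U T⊆U))
      (no T⊈U) → let (r , r∈T , r∉U) = p⊈q⇒∃∈∉ T⊈U in
        homotopy r x , homotopy-InC r x x∈C , λ T'' → case U ⊆? T'' of λ where
          (yes U⊆T'') → begin
            d B T (homotopy r x) T'' U
              ≈⟨ identityʳ _ ⟨
            d B T (homotopy r x) T'' U ∙ ε
              ≈⟨ ∙-congˡ (homotopy-vanishes r (d B T x) T'' (λ T' → dx≈0 T' U)) ⟨
            d B T (homotopy r x) T'' U ∙ homotopy r (d B T x) T'' U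
              ≈⟨ homotopy-formula x T'' r∈T r∉U U⊆T'' ⟩
            x T'' U ∎
          (no U⊈T'') → trans (d-⊈ (homotopy r x) T'' U⊈T'')
                               (sym (x∈C T'' U λ (_ , _ , U⊆T'') → U⊈T'' U⊆T''))

    cocycle-vanishes-at-⊤ : ∀ x → (∀ T'' → d B T x T'' U ≈ ε) → ¬ T ⊆ U → x ⊤ U ≈ ε
    cocycle-vanishes-at-⊤ x dx≈0 T⊈U with p⊈q⇒∃∈∉ T⊈U
    ... | r , r∈T , r∉U = begin
      x ⊤ U
        ≈⟨ homotopy-formula x ⊤ r∈T r∉U ⊆⊤ ⟨
      d B T (homotopy r x) ⊤ U ∙ homotopy r (d B T x) ⊤ U
        ≈⟨ ∙-cong (d-vanishes (homotopy r x) ⊤ λ _ _ _ i∉⊤ → contradiction ∈⊤ i∉⊤)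
                  (homotopy-vanishes r (d B T x) ⊤ dx≈0) ⟩
      ε ∙ ε
        ≈⟨ identityˡ ε ⟩
      ε ∎

    InC-zero-vanishes-if-at-⊤ : ∀ x → InC B T 0 x → x ⊤ U ≈ ε → ∀ T' → x T' U ≈ ε
    InC-zero-vanishes-if-at-⊤ x x∈C x⊤≈ε T' = case ∣ T' ∣ ≟ s of λ where
      (yes size) → ≡.subst (λ t → x t U ≈ ε) (≡.sym (∣p∣≡n⇒p≡⊤ size)) x⊤≈ε
      (no size)  → x∈C T' U λ (_ , size′ , _) → size (≡.trans (≡.sym (+-identityʳ ∣ T' ∣)) size′)

    cocycle-if-vanishes-at-⊤ : ∀ x → InC B T 0 x → (¬ T ⊆ U → x ⊤ U ≈ ε) → ∀ T'' → d B T x T'' U ≈ ε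
    cocycle-if-vanishes-at-⊤ x x∈C x⊤≈ε T'' = case T ⊆? U of λ where
      (yes T⊆U) → d-vanishes x T'' λ U⊆T'' _ i∈T i∉T'' → contradiction (U⊆T'' (T⊆U i∈T)) i∉T''
      (no T⊈U)  → d-vanishes x T'' λ _ i _ _ →
        InC-zero-vanishes-if-at-⊤ x x∈C (x⊤≈ε T⊈U) (T'' ∪ ⁅ i ⁆)

  exact-in-positive-degrees : ∀ n x → InC B T (suc n) x → IsZero B (d B T x) →
    Σ (Cochain B) λ y → InC B T n y × _≋_ B (d B T y) x
  exact-in-positive-degrees n x x∈C dx≈0 = glued , glued∈C , d-glued≋x
    where
    preimage : ∀ U → Σ (Cochain B) λ y → InC B T n y × (∀ T'' → Bᵤ._≈_ U (d B T y T'' U) (x T'' U))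
    preimage U = Summand.exact-on-summand U x x∈C dx≈0

    glued : Cochain B
    glued T' U = proj₁ (preimage U) T' U

    glued∈C : InC B T n glued
    glued∈C T' U = proj₁ (proj₂ (preimage U)) T' U

    d-glued≋x : _≋_ B (d B T glued) x
    d-glued≋x T'' U = Bᵤ.trans U (Summand.d-cong U T'' λ _ → Bᵤ.refl U) (proj₂ (proj₂ (preimage U)) T'')

  degree-zero-cocycles : ∀ x → InC B T 0 x →
    IsZero B (d B T x) ⇔ ((U : Subset s) → ¬ (T ⊆ U) → Bᵤ._≈_ U (x ⊤ U) (Bᵤ.ε U))
  degree-zero-cocycles x x∈C = mk⇔
    (λ dx≈0 U → Summand.cocycle-vanishes-at-⊤ U x (λ T'' → dx≈0 T'' U))
    (λ x⊤≈ε T'' U → Summand.cocycle-if-vanishes-at-⊤ U x x∈C (x⊤≈ε U) T'')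

mainTheorem6 : {c ℓ : Level} (s : ℕ) (B : Subset s → AbelianGroup c ℓ) (T : Subset s) →
    ((n : ℕ) (x : Cochain B) → InC B T (suc n) x → IsZero B (d B T x) →
      Σ (Cochain B) (λ y → InC B T n y × _≋_ B (d B T y) x))
    × ((x : Cochain B) → InC B T 0 x →
      (IsZero B (d B T x) ⇔ ((U : Subset s) → ¬ (T ⊆ U) → AbelianGroup._≈_ (B U) (x ⊤ U) (AbelianGroup.ε (B U)))))
mainTheorem6 s B T = exact-in-positive-degrees , degree-zero-cocycles
  where open Complex B T
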